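{- Let $G$ be a finite group and $\mathcal S$ a set of 3-element subsets of $G$ forming a commutative triplet structure (conditions (0)–(E) below). Consider the directed graph on $G\times\mathcal T$ with an edge $(g,\tau)\to(g',\tau')$ whenever the $((g',\tau'),(g,\tau))$ entry of the operator $T=\tfrac12P_R+\tfrac12P_RP_B$ is positive. Then the map $(g,\tau)\mapsto e(g,\tau)$ from $G\times\mathcal T$ to $E^1$ is a graph homomorphism to $G_{walk}$: whenever $(g,\tau)\to(g',\tau')$ (in either direction), $e(g,\tau)$ and $e(g',\tau')$ are adjacent in $G_{walk}$. Moreover, this map is 2-to-1.
   Context: Types: $\mathcal T$ is the set of 2-element subsets $\{a,b\}\subset G$ contained in some member of $\mathcal S$; $\mathcal T_o$ is the set of ordered pairs $(a,b)$ with $\{a,b\}\in\mathcal T$, and $(a,b)^{ -1}:=(b^{ -1},a^{ -1})$. The hypergraph $H$ has vertex set $G$ and triples $\{sg,s'g,s''g\}$, $g\in G$, $\{s,s',s''\}\in\mathcal S$. For $g\in G$, $\tau=\{a,b\}\in\mathcal T$, $e(g,\tau):=\{ag,bg\}$; the skeleton $E^1$ is the set of all $e(g,\tau)$. For $\tau=\{a,b\}$ with $ab=ba$ write $\tau g:=abg$, $\tau^{ -1}:=\{a^{ -1},b^{ -1}\}$. $L$ is the graph on $\mathcal T$ with $\tau\sim\tau'$ iff $\tau\ne\tau'$ and some member of $\mathcal S$ contains $\tau\cup\tau'$. $G_{walk}$ has vertex set $E^1$, with $\mathcal E\sim\mathcal E'$ iff $\mathcal E\ne\mathcal E'$ and some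 triple of $H$ contains $\mathcal E\cup\mathcal E'$. On $\mathbb R^{G\times\mathcal T}$: $P_R$ is the normalized adjacency operator of the red edges $(g,\tau)\sim(g,\tau')$ for $\tau\sim\tau'$ in $L$, and $P_B$ is the permutation matrix of the blue matching $(g,\tau)\leftrightarrow(\tau g,\tau^{ -1})$. Conditions: (0) no $\tau\in\mathcal T$ has the form $\{s,s^{ -1}\}$; (A) if $t\in\mathcal T_o$ then $t^{ -1}\in\mathcal T_o$; (B) for $t\neq t'$ in $\mathcal T_o$, $t_1t_2^{ -1}=t'_1(t'_2)^{ -1}$ implies $t'_2=t_1^{ -1}$ and $t'_1=t_2^{ -1}$; (C) every $\tau\in\mathcal T$ is contained in exactly $\tilde d$ members of $\mathcal S$; (D) $L$ is connected; (E) for every $\{a,b\}\in\mathcal T$, $ab=ba$. -}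

module Defs where

open import Level using (0ℓ)
open import Data.Nat as ℕ using (ℕ; zero; suc)
open import Data.Integer using (+_)
open import Data.Rational as ℚ using (ℚ; 0ℚ; ½) renaming (_+_ to _+ℚ_; _*_ to _*ℚ_; _<_ to _<ℚ_)
open import Data.Fin using (Fin)
open import Data.Fin.Properties using () renaming (_≟_ to _≟ᶠ_)
open import Data.Fin.Subset using (Subset; _⊆_; _∪_; ⁅_⁆; ∣_∣; inside; outside)
open import Data.Fin.Subset.Properties using (_⊆?_; _∈?_)
open import Data.Bool using (Bool; true; false; if_then_else_)
open import Data.Bool.Properties using () renaming (_≟_ to _≟ᵇ_)
open import Data.Vec using (Vec; []; _∷_; lookup; tabulate)
open import Data.Vec.Properties using (≡-dec)
open import Data.List using (List; []; _∷_; _++_; map; filter; length; foldr; allFin; cartesianProduct)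
open import Data.List.Membership.Propositional using (_∈_)
open import Data.List.Relation.Unary.Any using (Any; any?)
open import Data.List.Relation.Unary.All using (All)
open import Data.List.Relation.Unary.Unique.Propositional using (Unique)
open import Data.Product using (Σ; ∃; ∃-syntax; _×_; _,_; proj₁; proj₂)
open import Data.Sum using (_⊎_)
open import Relation.Nullary using (¬_; Dec; yes; no; does)
open import Relation.Nullary.Decidable using (_×-dec_; ¬?)
open import Relation.Binary.PropositionalEquality using (_≡_; _≢_)
open import Relation.Binary.Construct.Closure.ReflexiveTransitive using (Star)
open import Algebra.Core using (Op₁; Op₂)
open import Algebra.Structures using (IsGroup)

-- A finite group, presented (up to isomorphism) on the carrier Fin n,
-- with propositional equality as the group equality.
record FinGroup : Set where
  field
    n       : ℕ
    _∙_     : Op₂ (Fin n)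
    ε       : Fin n
    _⁻¹     : Op₁ (Fin n)
    isGroup : IsGroup _≡_ _∙_ ε _⁻¹

allSubsets : ∀ m → List (Subset m)
allSubsets zero    = [] ∷ []
allSubsets (suc m) = map (outside ∷_) (allSubsets m) ++ map (inside ∷_) (allSubsets m)

_≟ˢ_ : ∀ {m} (p q : Subset m) → Dec (p ≡ q)
_≟ˢ_ = ≡-dec _≟ᵇ_

-- 1/k as a rational (with the harmless convention 1/0 = 0)
inv : ℕ → ℚ
inv zero    = 0ℚ
inv (suc k) = + 1 ℚ./ suc k

sumℚ : List ℚ → ℚ
sumℚ = foldr _+ℚ_ 0ℚ

module Construction (G : FinGroup) (S : List (Subset (FinGroup.n G))) where
  open FinGroup G

  Elt : Set
  Elt = Fin n

  Sub : Set
  Sub = Subset n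

  -- the 2-element subset {a , b} (a 1-element subset if a ≡ b)
  pair : Elt → Elt → Sub
  pair a b = ⁅ a ⁆ ∪ ⁅ b ⁆

  -- right translate: A g = { a g | a ∈ A }   (x ∈ A g  iff  x g⁻¹ ∈ A)
  rtrans : Sub → Elt → Sub
  rtrans A g = tabulate (λ x → lookup A (x ∙ (g ⁻¹)))

  invSet : Sub → Sub
  invSet A = tabulate (λ x → lookup A (x ⁻¹))

  elems : Sub → List Elt
  elems A = filter (λ x → x ∈? A) (allFin n)

  -- product of the elements of a subset; for τ = {a , b} this is a b
  -- (well defined as ab = ba under condition (E))
  prodSet : Sub → Elt
  prodSet A = foldr _∙_ ε (elems A)

  InT : Sub → Set
  InT τ = ∣ τ ∣ ≡ 2 × Any (τ ⊆_) S

  InT? : (τ : Sub) → Dec (InT τ)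
  InT? τ = (∣ τ ∣ ℕ.≟ 2) ×-dec any? (τ ⊆?_) S

  InTo : Elt → Elt → Set
  InTo a b = InT (pair a b)

  e : Elt → Sub → Sub
  e g τ = rtrans τ g

  τact : Sub → Elt → Elt
  τact τ g = prodSet τ ∙ g

  LAdj : Sub → Sub → Set
  LAdj τ τ' = InT τ × InT τ' × τ ≢ τ' × Any (λ s → (τ ∪ τ') ⊆ s) S

  LAdj? : (τ τ' : Sub) → Dec (LAdj τ τ')
  LAdj? τ τ' = InT? τ ×-dec (InT? τ' ×-dec (¬? (τ ≟ˢ τ') ×-dec any? (λ s → (τ ∪ τ') ⊆? s) S))

  InH : Sub → Set
  InH X = ∃[ s ] ∃[ g ] (s ∈ S × X ≡ rtrans s g)

  InE1 : Sub → Set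
  InE1 X = ∃[ g ] ∃[ τ ] (InT τ × X ≡ e g τ)

  WalkAdj : Sub → Sub → Set
  WalkAdj X Y = InE1 X × InE1 Y × X ≢ Y × ∃[ Z ] (InH Z × (X ∪ Y) ⊆ Z)

  Tlist : List Sub
  Tlist = filter InT? (allSubsets n)

  Index : Set
  Index = Elt × Sub

  idx : List Index
  idx = cartesianProduct (allFin n) Tlist

  degL : Sub → ℕ
  degL τ = length (filter (LAdj? τ) Tlist)

  PR : Index → Index → ℚ
  PR (g , τ) (g' , τ') =
    if does ((g ≟ᶠ g') ×-dec LAdj? τ τ') then inv (degL τ) else 0ℚ

  PB : Index → Index → ℚ
  PB (h , σ) (g , τ) =
    if does ((h ≟ᶠ τact τ g) ×-dec (σ ≟ˢ invSet τ)) then + 1 ℚ./ 1 else 0ℚ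

  _⊗_ : (Index → Index → ℚ) → (Index → Index → ℚ) → (Index → Index → ℚ)
  (M ⊗ N) i j = sumℚ (map (λ k → M i k *ℚ N k j) idx)

  Top : Index → Index → ℚ
  Top i j = (½ *ℚ PR i j) +ℚ (½ *ℚ (PR ⊗ PB) i j)

  Edge : Index → Index → Set
  Edge (g , τ) (g' , τ') = 0ℚ <ℚ Top (g' , τ') (g , τ)

  record CommTriplet : Set where
    field
      S-unique   : Unique S
      S-triples  : All (λ s → ∣ s ∣ ≡ 3) S
      cond0      : ∀ τ → InT τ → ∀ s → τ ≢ pair s (s ⁻¹)
      condA      : ∀ a b → InTo a b → InTo (b ⁻¹) (a ⁻¹)
      condB      : ∀ t₁ t₂ t₁' t₂' → InTo t₁ t₂ → InTo t₁' t₂' →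
                   (t₁ , t₂) ≢ (t₁' , t₂') →
                   t₁ ∙ (t₂ ⁻¹) ≡ t₁' ∙ (t₂' ⁻¹) →
                   t₂' ≡ t₁ ⁻¹ × t₁' ≡ t₂ ⁻¹
      d̃          : ℕ
      condC      : ∀ τ → InT τ → length (filter (τ ⊆?_) S) ≡ d̃
      condD      : ∀ τ τ' → InT τ → InT τ' → Star LAdj τ τ'
      condE      : ∀ a b → InTo a b → a ∙ b ≡ b ∙ a

module Submission where

-- Proof idea.  Every τ ∈ 𝒯 is a doubleton {a , b} with a ≠ b and ab = ba, so
-- e(g , τ) = {ag , bg} is the right translate of τ by g.
--
-- A positive entry T_{(g',τ'),(g,τ)} comes either from a red
-- edge (g' = g, τ' ~ τ in L) or from a red edge into the blue partner
-- (τ g , τ⁻¹) of (g , τ).  A red edge maps to two distinct edges of a common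
-- translate s g of some s ∈ 𝒮, i.e. to adjacent vertices of G_walk; and the
-- blue partner has the same image, e(τ g , τ⁻¹) = {b⁻¹abg , a⁻¹abg} = {ag , bg},
-- by commutativity (E).
--
-- The fibre of e(g , τ) contains (g , τ) and its blue partner, which
-- are distinct by (0) and both in G × 𝒯 by (A).  Conversely, if
-- {ch , dh} = {ag , bg}, then after matching elements (c , d) is (a , b) — and
-- then h = g — or, by (B) applied to the equal quotients cd⁻¹ = ab⁻¹, it is
-- (b⁻¹ , a⁻¹) — and then h = abg.

open import Defs
open import Level using (0ℓ)
open import Function using (_∘_; id)
open import Data.Nat using (ℕ; zero; suc)
import Data.Nat.Properties as ℕ
open import Data.Fin using (Fin; zero; suc)
open import Data.Fin.Properties using (suc-injective) renaming (_≟_ to _≟ᶠ_)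
open import Data.Fin.Subset using (Subset; _∈_; _⊆_; _∪_; ⁅_⁆; ∣_∣; ⊥; inside; outside)
open import Data.Fin.Subset.Properties
  using (_∈?_; x∈⁅x⁆; x∈⁅y⁆⇒x≡y; ⊆-antisym; ∪-comm; ∪-identityˡ; p⊆p∪q; q⊆p∪q; x∈p∪q⁻; x∈p∪q⁺)
open import Data.Vec using ([]; _∷_; lookup; tabulate)
open import Data.Vec.Properties using (lookup∘tabulate; []=⇒lookup; lookup⇒[]=)
open import Data.List as List using (List; []; _∷_; map; filter; foldr; allFin)
open import Data.List.Membership.Propositional using (find)
open import Data.Product using (∃-syntax; _×_; _,_; proj₁; proj₂)
open import Data.Sum as Sum using (_⊎_; inj₁; inj₂)
open import Data.Empty using (⊥-elim)
open import Data.Bool using (true; false; if_then_else_)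
open import Relation.Nullary using (¬_; Dec; yes; no; does; _×-dec_)
open import Relation.Binary.PropositionalEquality
open import Algebra.Bundles using (Group)
open import Algebra.Structures using (IsGroup)
import Algebra.Properties.Group as GroupProperties
open import Data.Rational using (ℚ; 0ℚ; 1ℚ; ½) renaming (_+_ to _+ℚ_; _*_ to _*ℚ_; _<_ to _<ℚ_; _≤_ to _≤ℚ_)
import Data.Rational.Properties as ℚ

module SubsetFacts where
  private
    variable
      m : ℕ
      a b c d x : Fin m
      p q r : Subset m

  -- The preimage { x | f x ∈ p }.  Right translates and inverse sets in Defs are
  -- preimages, under x ↦ x g⁻¹ and x ↦ x⁻¹ respectively.
  preimage : (Fin m → Fin m) → Subset m → Subset m
  preimage f p = tabulate (λ x → lookup p (f x))

  ∈-preimage⁻ : ∀ {f : Fin m → Fin m} → x ∈ preimage f p → f x ∈ p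
  ∈-preimage⁻ {x = x} {p = p} {f} x∈ =
    lookup⇒[]= (f x) p (trans (sym (lookup∘tabulate (λ y → lookup p (f y)) x)) ([]=⇒lookup x∈))

  ∈-preimage⁺ : ∀ {f : Fin m → Fin m} → f x ∈ p → x ∈ preimage f p
  ∈-preimage⁺ {x = x} {p = p} {f} fx∈ =
    lookup⇒[]= x _ (trans (lookup∘tabulate (λ y → lookup p (f y)) x) ([]=⇒lookup fx∈))

  preimage-∪-⊆ : ∀ (f : Fin m → Fin m) → p ∪ q ⊆ r → preimage f p ∪ preimage f q ⊆ preimage f r
  preimage-∪-⊆ {p = p} {q = q} f p∪q⊆r x∈ =
    ∈-preimage⁺ (p∪q⊆r (x∈p∪q⁺ (Sum.map ∈-preimage⁻ ∈-preimage⁻ (x∈p∪q⁻ (preimage f p) (preimage f q) x∈))))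

  preimage-injective : ∀ (f f' : Fin m → Fin m) → (∀ y → f (f' y) ≡ y) →
                       preimage f p ≡ preimage f q → p ≡ q
  preimage-injective f f' section eq = ⊆-antisym (transfer eq) (transfer (sym eq))
    where
    transfer : ∀ {p q} → preimage f p ≡ preimage f q → p ⊆ q
    transfer {p} {q} eq {y} y∈p =
      subst (_∈ q) (section y)
        (∈-preimage⁻ (subst (f' y ∈_) eq (∈-preimage⁺ (subst (_∈ p) (sym (section y)) y∈p))))

  doubleton : Fin m → Fin m → Subset m
  doubleton a b = ⁅ a ⁆ ∪ ⁅ b ⁆

  ∈-doubleton⁻ : x ∈ doubleton a b → x ≡ a ⊎ x ≡ b
  ∈-doubleton⁻ {a = a} {b = b} x∈ = Sum.map (x∈⁅y⁆⇒x≡y a) (x∈⁅y⁆⇒x≡y b) (x∈p∪q⁻ ⁅ a ⁆ ⁅ b ⁆ x∈)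

  ∈-doubleton⁺ : x ≡ a ⊎ x ≡ b → x ∈ doubleton a b
  ∈-doubleton⁺ {b = b} (inj₁ refl) = p⊆p∪q ⁅ b ⁆ (x∈⁅x⁆ _)
  ∈-doubleton⁺ {a = a} (inj₂ refl) = q⊆p∪q ⁅ a ⁆ _ (x∈⁅x⁆ _)

  doubleton-comm : ∀ (a b : Fin m) → doubleton a b ≡ doubleton b a
  doubleton-comm a b = ∪-comm ⁅ a ⁆ ⁅ b ⁆

  doubleton-≡ : c ≢ d → doubleton c d ≡ doubleton a b → (c ≡ a × d ≡ b) ⊎ (c ≡ b × d ≡ a)
  doubleton-≡ {c = c} {d = d} c≢d eq
    with ∈-doubleton⁻ (subst (c ∈_) eq (∈-doubleton⁺ (inj₁ refl)))
       | ∈-doubleton⁻ (subst (d ∈_) eq (∈-doubleton⁺ (inj₂ refl)))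
  ... | inj₁ c≡a | inj₁ d≡a = ⊥-elim (c≢d (trans c≡a (sym d≡a)))
  ... | inj₁ c≡a | inj₂ d≡b = inj₁ (c≡a , d≡b)
  ... | inj₂ c≡b | inj₁ d≡a = inj₂ (c≡b , d≡a)
  ... | inj₂ c≡b | inj₂ d≡b = ⊥-elim (c≢d (trans c≡b (sym d≡b)))

  preimage-doubleton : ∀ (f f' : Fin m → Fin m) → (∀ y → f (f' y) ≡ y) → (∀ y → f' (f y) ≡ y) →
                       preimage f (doubleton a b) ≡ doubleton (f' a) (f' b)
  preimage-doubleton {a = a} {b = b} f f' section retraction = ⊆-antisym forward backward
    where
    forward : preimage f (doubleton a b) ⊆ doubleton (f' a) (f' b)
    forward {x} x∈ = ∈-doubleton⁺ (Sum.map (λ fx≡a → trans (sym (retraction x)) (cong f' fx≡a))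
                                           (λ fx≡b → trans (sym (retraction x)) (cong f' fx≡b))
                                           (∈-doubleton⁻ (∈-preimage⁻ {p = doubleton a b} x∈)))
    backward : doubleton (f' a) (f' b) ⊆ preimage f (doubleton a b)
    backward {x} x∈ = ∈-preimage⁺ (∈-doubleton⁺ (Sum.map (λ x≡f'a → trans (cong f x≡f'a) (section a))
                                                         (λ x≡f'b → trans (cong f x≡f'b) (section b))
                                                         (∈-doubleton⁻ x∈)))

  elements : Subset m → List (Fin m)
  elements p = filter (λ x → x ∈? p) (allFin _)

  filter-suc : ∀ {k} (f : Fin k → Fin m) s p →
               filter (λ x → x ∈? (s ∷ p)) (List.tabulate (suc ∘ f))
               ≡ map suc (filter (λ x → x ∈? p) (List.tabulate f))
  filter-suc {k = zero}  f s p = refl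
  filter-suc {k = suc k} f s p with does (f zero ∈? p)
  ... | true  = cong (suc (f zero) ∷_) (filter-suc (f ∘ suc) s p)
  ... | false = filter-suc (f ∘ suc) s p

  elements-outside : ∀ (p : Subset m) → elements (outside ∷ p) ≡ map suc (elements p)
  elements-outside p = filter-suc id outside p

  elements-inside : ∀ (p : Subset m) → elements (inside ∷ p) ≡ zero ∷ map suc (elements p)
  elements-inside p = cong (zero ∷_) (filter-suc id inside p)

  empty-subset : ∀ (p : Subset m) → ∣ p ∣ ≡ 0 → elements p ≡ [] × p ≡ ⊥
  empty-subset []            _ = refl , refl
  empty-subset (inside ∷ p)  ()
  empty-subset (outside ∷ p) ∣p∣≡0 with empty-subset p ∣p∣≡0
  ... | listing , shape = trans (elements-outside p) (cong (map suc) listing) , cong (outside ∷_) shape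

  singleton-subset : ∀ (p : Subset m) → ∣ p ∣ ≡ 1 → ∃[ a ] (elements p ≡ a ∷ [] × p ≡ ⁅ a ⁆)
  singleton-subset []            ()
  singleton-subset (outside ∷ p) ∣p∣≡1 with singleton-subset p ∣p∣≡1
  ... | a , listing , shape =
    suc a , trans (elements-outside p) (cong (map suc) listing) , cong (outside ∷_) shape
  singleton-subset (inside ∷ p) ∣p∣≡1 with empty-subset p (ℕ.suc-injective ∣p∣≡1)
  ... | listing , shape =
    zero , trans (elements-inside p) (cong (λ l → zero ∷ map suc l) listing) , cong (inside ∷_) shape

  record TwoElements (p : Subset m) : Set where
    field
      first second : Fin m
      distinct     : first ≢ second
      listing      : elements p ≡ first ∷ second ∷ []
      shape        : p ≡ doubleton first second

  two-element-subset : ∀ (p : Subset m) → ∣ p ∣ ≡ 2 → TwoElements p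
  two-element-subset []            ()
  two-element-subset (outside ∷ p) ∣p∣≡2 = record
    { first    = suc first
    ; second   = suc second
    ; distinct = distinct ∘ suc-injective
    ; listing  = trans (elements-outside p) (cong (map suc) listing)
    ; shape    = cong (outside ∷_) shape
    }
    where open TwoElements (two-element-subset p ∣p∣≡2)
  two-element-subset (inside ∷ p) ∣p∣≡2 with singleton-subset p (ℕ.suc-injective ∣p∣≡2)
  ... | b , listing , shape = record
    { first    = zero
    ; second   = suc b
    ; distinct = λ ()
    ; listing  = trans (elements-inside p) (cong (λ l → zero ∷ map suc l) listing)
    ; shape    = cong (inside ∷_) (trans shape (sym (∪-identityˡ ⁅ b ⁆)))
    }

open SubsetFacts

-- Positivity of rationals.  The entries of T are sums of products of weights
-- and 0/1-indicators; these facts locate the nonzero term behind a positive entry.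

0≮0 : ¬ (0ℚ <ℚ 0ℚ)
0≮0 = ℚ.<-irrefl refl

positive-+ : ∀ {x y} → 0ℚ <ℚ x +ℚ y → 0ℚ <ℚ x ⊎ 0ℚ <ℚ y
positive-+ {x} {y} 0<x+y with 0ℚ ℚ.<? x | 0ℚ ℚ.<? y
... | yes 0<x | _       = inj₁ 0<x
... | no _    | yes 0<y = inj₂ 0<y
... | no 0≮x  | no 0≮y  = ⊥-elim (0≮0 (ℚ.<-≤-trans 0<x+y (ℚ.+-mono-≤ (ℚ.≮⇒≥ 0≮x) (ℚ.≮⇒≥ 0≮y))))

positive-½* : ∀ {x} → 0ℚ <ℚ ½ *ℚ x → 0ℚ <ℚ x
positive-½* {x} 0<½x with 0ℚ ℚ.<? x
... | yes 0<x = 0<x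
... | no 0≮x  = ⊥-elim (0≮0 (ℚ.<-≤-trans 0<½x ½x≤0))
  where
  ½x≤0 : ½ *ℚ x ≤ℚ 0ℚ
  ½x≤0 = subst (½ *ℚ x ≤ℚ_) (ℚ.*-zeroʳ ½) (ℚ.*-monoˡ-≤-nonNeg ½ (ℚ.≮⇒≥ 0≮x))

positive-sum : ∀ {A : Set} (f : A → ℚ) (l : List A) → 0ℚ <ℚ sumℚ (map f l) → ∃[ k ] 0ℚ <ℚ f k
positive-sum f []      0<0     = ⊥-elim (0≮0 0<0)
positive-sum f (k ∷ l) 0<sum with positive-+ 0<sum
... | inj₁ 0<fk = k , 0<fk
... | inj₂ 0<rest = positive-sum f l 0<rest

positive-if : ∀ {P : Set} (P? : Dec P) (v : ℚ) → 0ℚ <ℚ (if does P? then v else 0ℚ) → P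
positive-if (yes p) v _   = p
positive-if (no _)  v 0<0 = ⊥-elim (0≮0 0<0)

positive-*-indicator : ∀ {P : Set} (x : ℚ) (P? : Dec P) →
                       0ℚ <ℚ x *ℚ (if does P? then 1ℚ else 0ℚ) → P × 0ℚ <ℚ x
positive-*-indicator x (yes p) 0<x1 = p , subst (0ℚ <ℚ_) (ℚ.*-identityʳ x) 0<x1
positive-*-indicator x (no _)  0<x0 = ⊥-elim (0≮0 (subst (0ℚ <ℚ_) (ℚ.*-zeroʳ x) 0<x0))

asGroup : FinGroup → Group 0ℓ 0ℓ
asGroup G = record
  { Carrier = Fin n ; _≈_ = _≡_ ; _∙_ = _∙_ ; ε = ε ; _⁻¹ = _⁻¹ ; isGroup = isGroup }
  where open FinGroup G

module Translation (G : FinGroup) (S : List (Subset (FinGroup.n G))) where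
  open FinGroup G
  open Construction G S
  open IsGroup isGroup using (assoc; identityʳ)
  open GroupProperties (asGroup G)
    using (\\-leftDividesˡ; //-rightDividesˡ; //-rightDividesʳ; ⁻¹-involutive; ⁻¹-anti-homo-∙)

  e-pair : ∀ g a b → e g (pair a b) ≡ pair (a ∙ g) (b ∙ g)
  e-pair g a b = preimage-doubleton (_∙ (g ⁻¹)) (_∙ g) (//-rightDividesʳ g) (//-rightDividesˡ g)

  invSet-pair : ∀ a b → invSet (pair a b) ≡ pair (a ⁻¹) (b ⁻¹)
  invSet-pair a b = preimage-doubleton _⁻¹ _⁻¹ ⁻¹-involutive ⁻¹-involutive

  e-injective : ∀ {h σ σ'} → e h σ ≡ e h σ' → σ ≡ σ'
  e-injective {h} = preimage-injective (_∙ (h ⁻¹)) (_∙ h) (//-rightDividesʳ h)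

  quotient-invariant : ∀ x y h → (x ∙ h) ∙ ((y ∙ h) ⁻¹) ≡ x ∙ (y ⁻¹)
  quotient-invariant x y h = begin
    (x ∙ h) ∙ ((y ∙ h) ⁻¹)       ≡⟨ cong ((x ∙ h) ∙_) (⁻¹-anti-homo-∙ y h) ⟩
    (x ∙ h) ∙ ((h ⁻¹) ∙ (y ⁻¹))  ≡⟨ assoc x h _ ⟩
    x ∙ (h ∙ ((h ⁻¹) ∙ (y ⁻¹)))  ≡⟨ cong (x ∙_) (\\-leftDividesˡ h (y ⁻¹)) ⟩
    x ∙ (y ⁻¹)                   ∎
    where open ≡-Reasoning

  same-quotient : ∀ {a b c d g h} → c ∙ h ≡ a ∙ g → d ∙ h ≡ b ∙ g → a ∙ (b ⁻¹) ≡ c ∙ (d ⁻¹)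
  same-quotient {a} {b} {c} {d} {g} {h} ch≡ag dh≡bg = begin
    a ∙ (b ⁻¹)              ≡⟨ quotient-invariant a b g ⟨
    (a ∙ g) ∙ ((b ∙ g) ⁻¹)  ≡⟨ cong₂ (λ u v → u ∙ (v ⁻¹)) ch≡ag dh≡bg ⟨
    (c ∙ h) ∙ ((d ∙ h) ⁻¹)  ≡⟨ quotient-invariant c d h ⟩
    c ∙ (d ⁻¹)              ∎
    where open ≡-Reasoning

  -- A red edge of L, sitting in a common member s ∈ 𝒮, maps to two distinct
  -- edges of the hypergraph triple s h.
  red-adjacent : ∀ h {σ σ'} → LAdj σ σ' → WalkAdj (e h σ) (e h σ')
  red-adjacent h {σ} {σ'} (σ∈𝒯 , σ'∈𝒯 , σ≢σ' , in-𝒮) with find in-𝒮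
  ... | s , s∈𝒮 , σ∪σ'⊆s =
    (h , σ , σ∈𝒯 , refl) , (h , σ' , σ'∈𝒯 , refl) , σ≢σ' ∘ e-injective ,
    e h s , (s , h , s∈𝒮 , refl) , preimage-∪-⊆ (_∙ (h ⁻¹)) σ∪σ'⊆s

  WalkAdj-sym : ∀ {X Y} → WalkAdj X Y → WalkAdj Y X
  WalkAdj-sym {X} {Y} (X∈E¹ , Y∈E¹ , X≢Y , Z , Z∈H , X∪Y⊆Z) =
    Y∈E¹ , X∈E¹ , X≢Y ∘ sym , Z , Z∈H , subst (_⊆ Z) (∪-comm X Y) X∪Y⊆Z

  record Shape (τ : Sub) : Set where
    field
      first second : Elt
      distinct     : first ≢ second
      shape        : τ ≡ pair first second
      product      : prodSet τ ≡ first ∙ second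

  shapeOf : ∀ τ → InT τ → Shape τ
  shapeOf τ (∣τ∣≡2 , _) = record
    { first = first ; second = second ; distinct = distinct ; shape = shape
    ; product = trans (cong (foldr _∙_ ε) listing) (cong (first ∙_) (identityʳ second))
    }
    where open TwoElements (two-element-subset τ ∣τ∣≡2)

module Triplet (G : FinGroup) (S : List (Subset (FinGroup.n G)))
               (CT : Construction.CommTriplet G S) where
  open FinGroup G
  open Construction G S
  open CommTriplet CT
  open Translation G S
  open IsGroup isGroup using (assoc)
  open GroupProperties (asGroup G)
    using (\\-leftDividesʳ; ∙-cancelˡ; ∙-cancelʳ; ⁻¹-involutive; identityˡ-unique; inverseʳ-unique)

  bluePartner : Index → Index
  bluePartner (g , τ) = τact τ g , invSet τ

  -- The blue partner has the same image: {a⁻¹·abg , b⁻¹·abg} = {bg , ag}, by (E).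
  blue-invariant : ∀ g τ → InT τ → e (τact τ g) (invSet τ) ≡ e g τ
  blue-invariant g τ τ∈𝒯 = begin
    e (prodSet τ ∙ g) (invSet τ)                              ≡⟨ cong₂ (λ u σ → e (u ∙ g) (invSet σ)) product shape ⟩
    e ((a ∙ b) ∙ g) (invSet (pair a b))                       ≡⟨ cong (e ((a ∙ b) ∙ g)) (invSet-pair a b) ⟩
    e ((a ∙ b) ∙ g) (pair (a ⁻¹) (b ⁻¹))                      ≡⟨ e-pair ((a ∙ b) ∙ g) (a ⁻¹) (b ⁻¹) ⟩
    pair ((a ⁻¹) ∙ ((a ∙ b) ∙ g)) ((b ⁻¹) ∙ ((a ∙ b) ∙ g))    ≡⟨ cong₂ pair cancel-a cancel-b ⟩
    pair (b ∙ g) (a ∙ g)                                      ≡⟨ doubleton-comm (b ∙ g) (a ∙ g) ⟩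
    pair (a ∙ g) (b ∙ g)                                      ≡⟨ e-pair g a b ⟨
    e g (pair a b)                                            ≡⟨ cong (e g) shape ⟨
    e g τ                                                     ∎
    where
    open ≡-Reasoning
    open Shape (shapeOf τ τ∈𝒯) renaming (first to a; second to b)
    cancel-a : (a ⁻¹) ∙ ((a ∙ b) ∙ g) ≡ b ∙ g
    cancel-a = trans (cong ((a ⁻¹) ∙_) (assoc a b g)) (\\-leftDividesʳ a (b ∙ g))
    cancel-b : (b ⁻¹) ∙ ((a ∙ b) ∙ g) ≡ a ∙ g
    cancel-b = begin
      (b ⁻¹) ∙ ((a ∙ b) ∙ g)  ≡⟨ cong (λ u → (b ⁻¹) ∙ (u ∙ g)) (condE a b (subst InT shape τ∈𝒯)) ⟩
      (b ⁻¹) ∙ ((b ∙ a) ∙ g)  ≡⟨ cong ((b ⁻¹) ∙_) (assoc b a g) ⟩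
      (b ⁻¹) ∙ (b ∙ (a ∙ g))  ≡⟨ \\-leftDividesʳ b (a ∙ g) ⟩
      a ∙ g                   ∎

  edge-support : ∀ g τ g' τ' → 0ℚ <ℚ Top (g' , τ') (g , τ) →
                 (g' ≡ g × LAdj τ' τ) ⊎ (g' ≡ τact τ g × LAdj τ' (invSet τ))
  edge-support g τ g' τ' 0<T with positive-+ 0<T
  ... | inj₁ 0<red =
    inj₁ (positive-if ((g' ≟ᶠ g) ×-dec LAdj? τ' τ) (inv (degL τ'))
                      (positive-½* {PR (g' , τ') (g , τ)} 0<red))
  ... | inj₂ 0<blue
    with positive-sum (λ k → PR (g' , τ') k *ℚ PB k (g , τ)) idx
                      (positive-½* {(PR ⊗ PB) (g' , τ') (g , τ)} 0<blue)
  ... | (k , σ) , 0<term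
    with positive-*-indicator (PR (g' , τ') (k , σ)) ((k ≟ᶠ τact τ g) ×-dec (σ ≟ˢ invSet τ)) 0<term
  ... | (refl , refl) , 0<red = inj₂ (positive-if ((g' ≟ᶠ k) ×-dec LAdj? τ' σ) (inv (degL τ')) 0<red)

  edge-adjacent : ∀ g τ g' τ' → InT τ → 0ℚ <ℚ Top (g' , τ') (g , τ) → WalkAdj (e g' τ') (e g τ)
  edge-adjacent g τ g' τ' τ∈𝒯 0<T with edge-support g τ g' τ' 0<T
  ... | inj₁ (refl , τ'~τ)   = red-adjacent g τ'~τ
  ... | inj₂ (refl , τ'~τ⁻¹) =
    subst (WalkAdj (e g' τ')) (blue-invariant g τ τ∈𝒯) (red-adjacent g' τ'~τ⁻¹)

  -- The blue partner lies in G × 𝒯, by (A) ...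
  partner-in-𝒯 : ∀ τ → InT τ → InT (invSet τ)
  partner-in-𝒯 τ τ∈𝒯 = subst InT (sym invτ≡) (condA a b (subst InT shape τ∈𝒯))
    where
    open Shape (shapeOf τ τ∈𝒯) renaming (first to a; second to b)
    invτ≡ : invSet τ ≡ pair (b ⁻¹) (a ⁻¹)
    invτ≡ = trans (cong invSet shape) (trans (invSet-pair a b) (doubleton-comm (a ⁻¹) (b ⁻¹)))

  -- ... and differs from (g , τ), by (0): τ g = g would force ab = 1, i.e. τ = {a , a⁻¹}.
  partner-distinct : ∀ g τ → InT τ → (g , τ) ≢ bluePartner (g , τ)
  partner-distinct g τ τ∈𝒯 same = cond0 τ τ∈𝒯 a (trans shape (cong (pair a) (inverseʳ-unique a b ab≡ε)))
    where
    open Shape (shapeOf τ τ∈𝒯) renaming (first to a; second to b)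
    ab≡ε : a ∙ b ≡ ε
    ab≡ε = identityˡ-unique (a ∙ b) g (sym (trans (cong proj₁ same) (cong (_∙ g) product)))

  Lift : Elt → Sub → Elt → Elt → Elt → Set
  Lift h σ g a b = (h ≡ g × σ ≡ pair a b) ⊎ (h ≡ (a ∙ b) ∙ g × σ ≡ pair (a ⁻¹) (b ⁻¹))

  Lift-swap : ∀ {h σ g a b} → a ∙ b ≡ b ∙ a → Lift h σ g b a → Lift h σ g a b
  Lift-swap {a = a} {b} ab≡ba (inj₁ (h≡g , σ≡)) = inj₁ (h≡g , trans σ≡ (doubleton-comm b a))
  Lift-swap {g = g} {a} {b} ab≡ba (inj₂ (h≡ , σ≡)) =
    inj₂ (trans h≡ (cong (_∙ g) (sym ab≡ba)) , trans σ≡ (doubleton-comm (b ⁻¹) (a ⁻¹)))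

  -- Ordered matching:  if ch = ag and dh = bg then (c , d) = (a , b) and h = g, or
  -- else (B), applied to the equal quotients cd⁻¹ = ab⁻¹, gives (c , d) = (b⁻¹ , a⁻¹)
  -- and h = bag = abg.
  ordered-match : ∀ {a b c d g h} → InTo a b → InTo c d → c ∙ h ≡ a ∙ g → d ∙ h ≡ b ∙ g →
                  Lift h (pair c d) g a b
  ordered-match {a} {b} {c} {d} {g} {h} ab∈𝒯 cd∈𝒯 ch≡ag dh≡bg with a ≟ᶠ c
  ... | yes refl = inj₁ (h≡g , cong (pair a) (∙-cancelʳ g d b (trans (cong (d ∙_) (sym h≡g)) dh≡bg)))
    where
    h≡g : h ≡ g
    h≡g = ∙-cancelˡ a h g ch≡ag
  ... | no a≢c with condB a b c d ab∈𝒯 cd∈𝒯 (a≢c ∘ cong proj₁) (same-quotient ch≡ag dh≡bg)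
  ...   | refl , refl = Lift-swap (condE a b ab∈𝒯) (inj₂ (h≡bag , refl))
    where
    h≡bag : h ≡ (b ∙ a) ∙ g
    h≡bag = begin
      h                          ≡⟨ \\-leftDividesʳ (b ⁻¹) h ⟨
      ((b ⁻¹) ⁻¹) ∙ ((b ⁻¹) ∙ h) ≡⟨ cong₂ _∙_ (⁻¹-involutive b) ch≡ag ⟩
      b ∙ (a ∙ g)                ≡⟨ assoc b a g ⟨
      (b ∙ a) ∙ g                ∎
      where open ≡-Reasoning

  pair-match : ∀ {a b c d g h} → InTo a b → InTo c d → c ≢ d →
               pair (c ∙ h) (d ∙ h) ≡ pair (a ∙ g) (b ∙ g) → Lift h (pair c d) g a b
  pair-match {a} {b} {c} {d} {g} {h} ab∈𝒯 cd∈𝒯 c≢d eq with doubleton-≡ (c≢d ∘ ∙-cancelʳ h c d) eq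
  ... | inj₁ (ch≡ag , dh≡bg) = ordered-match ab∈𝒯 cd∈𝒯 ch≡ag dh≡bg
  ... | inj₂ (ch≡bg , dh≡ag) =
    Lift-swap (condE a b ab∈𝒯) (ordered-match (subst InT (doubleton-comm a b) ab∈𝒯) cd∈𝒯 ch≡bg dh≡ag)

  fibre : ∀ g τ h σ → InT τ → InT σ → e h σ ≡ e g τ →
          (h , σ) ≡ (g , τ) ⊎ (h , σ) ≡ bluePartner (g , τ)
  fibre g τ h σ τ∈𝒯 σ∈𝒯 eq =
    Sum.map same-lift partner-lift
      (pair-match (subst InT τ.shape τ∈𝒯) (subst InT σ.shape σ∈𝒯) σ.distinct translated)
    where
    module τ = Shape (shapeOf τ τ∈𝒯)
    module σ = Shape (shapeOf σ σ∈𝒯)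
    a = τ.first
    b = τ.second
    c = σ.first
    d = σ.second
    translated : pair (c ∙ h) (d ∙ h) ≡ pair (a ∙ g) (b ∙ g)
    translated = begin
      pair (c ∙ h) (d ∙ h)  ≡⟨ e-pair h c d ⟨
      e h (pair c d)        ≡⟨ cong (e h) σ.shape ⟨
      e h σ                 ≡⟨ eq ⟩
      e g τ                 ≡⟨ cong (e g) τ.shape ⟩
      e g (pair a b)        ≡⟨ e-pair g a b ⟩
      pair (a ∙ g) (b ∙ g)  ∎
      where open ≡-Reasoning
    same-lift : h ≡ g × pair c d ≡ pair a b → (h , σ) ≡ (g , τ)
    same-lift (h≡g , cd≡ab) = cong₂ _,_ h≡g (trans σ.shape (trans cd≡ab (sym τ.shape)))
    partner-lift : h ≡ (a ∙ b) ∙ g × pair c d ≡ pair (a ⁻¹) (b ⁻¹) → (h , σ) ≡ bluePartner (g , τ)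
    partner-lift (h≡abg , cd≡) =
      cong₂ _,_ (trans h≡abg (cong (_∙ g) (sym τ.product)))
                (trans σ.shape (trans cd≡ (sym (trans (cong invSet τ.shape) (invSet-pair a b)))))

mainTheorem7 :
    (G : FinGroup) (S : List (Subset (FinGroup.n G))) →
    let open Construction G S in
    CommTriplet →
    -- graph homomorphism: edges (in either direction) map to G_walk-adjacent pairs
    (∀ g τ g' τ' → InT τ → InT τ' →
       (Edge (g , τ) (g' , τ') ⊎ Edge (g' , τ') (g , τ)) →
       WalkAdj (e g τ) (e g' τ'))
    ×
    -- 2-to-1: every vertex of E¹ has exactly two preimages in G × 𝒯
    (∀ X → InE1 X →
       ∃[ i₁ ] ∃[ i₂ ]
         (InT (proj₂ i₁) × InT (proj₂ i₂) × i₁ ≢ i₂ ×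
          e (proj₁ i₁) (proj₂ i₁) ≡ X × e (proj₁ i₂) (proj₂ i₂) ≡ X ×
          (∀ g τ → InT τ → e g τ ≡ X → (g , τ) ≡ i₁ ⊎ (g , τ) ≡ i₂)))
mainTheorem7 G S CT = homomorphism , two-to-one
  where
  open Construction G S
  open Translation G S
  open Triplet G S CT

  homomorphism : ∀ g τ g' τ' → InT τ → InT τ' →
                 (Edge (g , τ) (g' , τ') ⊎ Edge (g' , τ') (g , τ)) → WalkAdj (e g τ) (e g' τ')
  homomorphism g τ g' τ' τ∈𝒯 τ'∈𝒯 (inj₁ forward)  = WalkAdj-sym (edge-adjacent g τ g' τ' τ∈𝒯 forward)
  homomorphism g τ g' τ' τ∈𝒯 τ'∈𝒯 (inj₂ backward) = edge-adjacent g' τ' g τ τ'∈𝒯 backward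

  two-to-one : ∀ X → InE1 X → ∃[ i₁ ] ∃[ i₂ ]
                 (InT (proj₂ i₁) × InT (proj₂ i₂) × i₁ ≢ i₂ ×
                  e (proj₁ i₁) (proj₂ i₁) ≡ X × e (proj₁ i₂) (proj₂ i₂) ≡ X ×
                  (∀ g τ → InT τ → e g τ ≡ X → (g , τ) ≡ i₁ ⊎ (g , τ) ≡ i₂))
  two-to-one X (g , τ , τ∈𝒯 , X≡egτ) =
    (g , τ) , bluePartner (g , τ) , τ∈𝒯 , partner-in-𝒯 τ τ∈𝒯 , partner-distinct g τ τ∈𝒯 ,
    sym X≡egτ , trans (blue-invariant g τ τ∈𝒯) (sym X≡egτ) ,
    λ h σ σ∈𝒯 ehσ≡X → fibre g τ h σ τ∈𝒯 σ∈𝒯 (trans ehσ≡X X≡egτ)
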